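{- Let $X=\{a,b,c\}$ (three distinct elements) with the quandle operation $\lhd$ given by $a\lhd x=a$ for all $x\in X$, $b\lhd a=c,\ b\lhd b=b,\ b\lhd c=b,\ c\lhd a=b,\ c\lhd b=c,\ c\lhd c=c$. Then a topology on $X$ is compatible with this quandle structure if and only if its associated quasi-order $\le$ is one of the following five: (1) the discrete one ($x\le y$ iff $x=y$); (2) the coarse one ($x\le y$ for all $x,y$); (3) $b\le c$, $c\le b$ and no other relations between distinct elements; (4) $b\le c$, $c\le b$, $a\le b$, $a\le c$, and neither $b\le a$ nor $c\le a$; (5) $b\le c$, $c\le b$, $b\le a$, $c\le a$, and neither $a\le b$ nor $a\le c$.
   Context: A topology $\mathcal{T}$ on a finite set $X$ corresponds bijectively to the quasi-order (reflexive, transitive relation) defined by $x\le y$ iff every open set containing $x$ also contains $y$; the open sets are exactly the upper sets of $\le$. A topology $\mathcal{T}$ on a quandle $(Q,\lhd)$ is called compatible ($Q$-compatible) if the map $Q\times Q\to Q$, $(x,y)\mapsto x\lhd y$, is continuous (product topology) and for every $y\in Q$ the map $x\mapsto x\lhd y$ is a homeomorphism of $(Q,\mathcal{T})$. -}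

module Defs where

open import Data.Bool using (Bool; true; false; T)
open import Data.Nat using (ℕ)
open import Data.Fin using (Fin; zero; suc)
open import Data.Fin.Subset using (Subset; ⊥; ⊤; _∪_; _∩_; _∈_)
open import Data.Vec using (tabulate; lookup)
open import Data.Product using (Σ; ∃; _×_; _,_)
open import Data.Sum using (_⊎_)
open import Data.Unit using () renaming (⊤ to Unit)
open import Relation.Binary.PropositionalEquality using (_≡_)
open import Function using (_∘_)

X : Set
X = Fin 3

a b c : X
a = zero
b = suc zero
c = suc (suc zero)

_◁_ : X → X → X
zero ◁ _ = a
suc zero ◁ zero = c
suc zero ◁ suc zero = b
suc zero ◁ suc (suc zero) = b
suc (suc zero) ◁ zero = b
suc (suc zero) ◁ suc zero = c
suc (suc zero) ◁ suc (suc zero) = c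

infixl 7 _◁_

-- A topology on the finite set Fin n: a (decidable) family of open subsets
-- containing ∅ and the whole set, closed under binary unions and binary
-- intersections (on a finite set, closure under arbitrary unions is
-- equivalent to closure under ∅ and binary unions).
record Topology (n : ℕ) : Set where
  field
    Open   : Subset n → Bool
    open-∅ : T (Open ⊥)
    open-X : T (Open ⊤)
    open-∪ : ∀ U V → T (Open U) → T (Open V) → T (Open (U ∪ V))
    open-∩ : ∀ U V → T (Open U) → T (Open V) → T (Open (U ∩ V))
open Topology public

IsOpen : ∀ {n} → Topology n → Subset n → Set
IsOpen τ U = T (Open τ U)

preimage : ∀ {m n} → (Fin m → Fin n) → Subset n → Subset m
preimage f U = tabulate (λ x → lookup U (f x))

Continuous : ∀ {n} → Topology n → (Fin n → Fin n) → Set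
Continuous τ f = ∀ U → IsOpen τ U → IsOpen τ (preimage f U)

Homeomorphism : ∀ {n} → Topology n → (Fin n → Fin n) → Set
Homeomorphism τ f =
  Σ (Fin _ → Fin _) λ g →
    (∀ x → g (f x) ≡ x) × (∀ y → f (g y) ≡ y) ×
    Continuous τ f × Continuous τ g

-- continuity of a binary operation Fin n × Fin n → Fin n w.r.t. the
-- product topology: the preimage of every open set U is open in the product
-- topology, i.e. every point of it has a basic open neighbourhood V × W
-- (V, W open) contained in it.
Continuous₂ : ∀ {n} → Topology n → (Fin n → Fin n → Fin n) → Set
Continuous₂ τ op =
  ∀ U → IsOpen τ U → ∀ x y → op x y ∈ U →
    Σ (Subset _) λ V → Σ (Subset _) λ W →
      IsOpen τ V × IsOpen τ W × x ∈ V × y ∈ W ×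
      (∀ x′ y′ → x′ ∈ V → y′ ∈ W → op x′ y′ ∈ U)

Compatible : Topology 3 → Set
Compatible τ = Continuous₂ τ _◁_ × (∀ y → Homeomorphism τ (λ x → x ◁ y))

_≤[_]_ : ∀ {n} → Fin n → Topology n → Fin n → Set
x ≤[ τ ] y = ∀ U → IsOpen τ U → x ∈ U → y ∈ U

InBC : X → Set
InBC x = x ≡ b ⊎ x ≡ c

R₁ R₂ R₃ R₄ R₅ : X → X → Set
R₁ x y = x ≡ y
R₂ x y = Unit
R₃ x y = x ≡ y ⊎ (InBC x × InBC y)
R₄ x y = R₃ x y ⊎ x ≡ a
R₅ x y = R₃ x y ⊎ y ≡ a

OrderIs : Topology 3 → (X → X → Set) → Set
OrderIs τ R = ∀ x y → (x ≤[ τ ] y → R x y) × (R x y → x ≤[ τ ] y)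

-- In a finite space the topology is determined by its specialisation preorder ≤:
-- every point x has a smallest open neighbourhood, the set of points above x,
-- and the open sets are exactly the upsets.  So a self-map is continuous iff it
-- is monotone, and a binary operation is jointly continuous iff it is monotone in
-- both arguments.  Each right translation x ↦ x ◁ y is an involution, hence
-- compatibility of τ amounts to monotonicity of ◁ for ≤.  Which preorders on
-- {a, b, c} make ◁ monotone is a finite question, settled by checking all 2⁹
-- Boolean relations on X.

module Submission where

open import Defs
open import Data.Bool using (Bool; T)
open import Data.Empty using (⊥-elim)
open import Data.Fin using (Fin; zero; suc; _≟_; combine; remQuot)
open import Data.Fin.Properties using (all?)
open import Data.Fin.Subset using (Subset; _∈_; _∉_; _⊆_; _∪_; _∩_) renaming (⊥ to ∅; ⊤ to full)
open import Data.Fin.Subset.Properties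
  using (_∈?_; anySubset?; ∈⊤; ∉⊥; x∈p∪q⁺; x∈p∪q⁻; x∈p∩q⁺; x∈p∩q⁻; ⊆-antisym)
open import Data.List using (List; []; _∷_; allFin)
open import Data.List.Membership.Propositional using () renaming (_∈_ to _∈ₗ_)
open import Data.List.Membership.Propositional.Properties using (∈-allFin)
open import Data.List.Relation.Unary.Any using (here; there)
open import Data.Nat using (ℕ; _*_)
open import Data.Product using (∃; _×_; _,_; proj₁; proj₂; uncurry)
open import Data.Sum using (_⊎_; inj₁; inj₂; [_,_]′)
open import Data.Unit using (tt)
open import Data.Vec using (lookup; tabulate)
open import Data.Vec.Properties using (lookup∘tabulate; []=⇒lookup; lookup⇒[]=)
open import Function using (_∘_)
open import Function.Bundles using (_⇔_; mk⇔; Equivalence)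
open import Function.Properties.Equivalence using () renaming (trans to ⇔-trans)
open import Level using (Level; _⊔_)
open import Relation.Binary.Core using (Rel; _Preserves_⟶_; _Preserves₂_⟶_⟶_)
open import Relation.Binary.Definitions using (Decidable; Reflexive; Transitive)
open import Relation.Binary.PropositionalEquality using (_≡_; refl; sym; trans; subst)
open import Relation.Nullary using (Dec; yes; no; does)
open import Relation.Nullary.Decidable
  using (T?; ¬?; map′; decidable-stable; _×-dec_; _⊎-dec_; _→-dec_)

private variable
  ℓ ℓ′ : Level
  n : ℕ

∈-preimage⁺ : ∀ {m} {f : Fin m → Fin n} {U x} → f x ∈ U → x ∈ preimage f U
∈-preimage⁺ {f = f} {U} {x} fx∈U =
  lookup⇒[]= x _ (trans (lookup∘tabulate (lookup U ∘ f) x) ([]=⇒lookup fx∈U))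

∈-preimage⁻ : ∀ {m} {f : Fin m → Fin n} {U x} → x ∈ preimage f U → f x ∈ U
∈-preimage⁻ {f = f} {U} {x} x∈f⁻¹U =
  lookup⇒[]= (f x) U (trans (sym (lookup∘tabulate (lookup U ∘ f) x)) ([]=⇒lookup x∈f⁻¹U))

module _ (τ : Topology n) where

  ≤-refl : Reflexive (_≤[ τ ]_)
  ≤-refl U _ x∈U = x∈U

  ≤-trans : Transitive (_≤[ τ ]_)
  ≤-trans x≤y y≤z U oU x∈U = y≤z U oU (x≤y U oU x∈U)

  ≤-or-separated : ∀ x y → x ≤[ τ ] y ⊎ ∃ λ U → IsOpen τ U × x ∈ U × y ∉ U
  ≤-or-separated x y with anySubset? (λ U → T? (Open τ U) ×-dec x ∈? U ×-dec ¬? (y ∈? U))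
  ... | yes separation = inj₂ separation
  ... | no no-separation =
    inj₁ λ U oU x∈U → decidable-stable (y ∈? U) λ y∉U → no-separation (U , oU , x∈U , y∉U)

  _≤?_ : Decidable (_≤[ τ ]_)
  x ≤? y with ≤-or-separated x y
  ... | inj₁ x≤y = yes x≤y
  ... | inj₂ (U , oU , x∈U , y∉U) = no λ x≤y → y∉U (x≤y U oU x∈U)

  open-nbhd-above : ∀ x (ys : List (Fin n)) →
    ∃ λ N → IsOpen τ N × x ∈ N × (∀ {y} → y ∈ₗ ys → y ∈ N → x ≤[ τ ] y)
  open-nbhd-above x [] = full , open-X τ , ∈⊤ , λ ()
  open-nbhd-above x (y ∷ ys) with open-nbhd-above x ys | ≤-or-separated x y
  ... | N , oN , x∈N , above | inj₁ x≤y = N , oN , x∈N , λ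
    { (here refl) _ → x≤y
    ; (there y∈ys) → above y∈ys }
  ... | N , oN , x∈N , above | inj₂ (U , oU , x∈U , y∉U) =
    N ∩ U , open-∩ τ N U oN oU , x∈p∩q⁺ (x∈N , x∈U) , λ
    { (here refl) y∈N∩U → ⊥-elim (y∉U (proj₂ (x∈p∩q⁻ N U y∈N∩U)))
    ; (there z∈ys) z∈N∩U → above z∈ys (proj₁ (x∈p∩q⁻ N U z∈N∩U)) }

  minimal-open-nbhd : ∀ x → ∃ λ N → IsOpen τ N × x ∈ N × (∀ {y} → y ∈ N → x ≤[ τ ] y)
  minimal-open-nbhd x with open-nbhd-above x (allFin n)
  ... | N , oN , x∈N , above = N , oN , x∈N , above (∈-allFin _)

  open-cover-of : ∀ V → (∀ {x} → x ∈ V → ∃ λ W → IsOpen τ W × x ∈ W × W ⊆ V) →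
    (xs : List (Fin n)) → ∃ λ O → IsOpen τ O × O ⊆ V × (∀ {x} → x ∈ₗ xs → x ∈ V → x ∈ O)
  open-cover-of V local [] = ∅ , open-∅ τ , ⊥-elim ∘ ∉⊥ , λ ()
  open-cover-of V local (x ∷ xs) with open-cover-of V local xs | x ∈? V
  ... | O , oO , O⊆V , covers | no x∉V = O , oO , O⊆V , λ
    { (here refl) x∈V → ⊥-elim (x∉V x∈V)
    ; (there y∈xs) → covers y∈xs }
  ... | O , oO , O⊆V , covers | yes x∈V with local x∈V
  ...   | W , oW , x∈W , W⊆V =
    O ∪ W , open-∪ τ O W oO oW ,
    (λ y∈O∪W → [ O⊆V , W⊆V ]′ (x∈p∪q⁻ O W y∈O∪W)) , λ
    { (here refl) _ → x∈p∪q⁺ (inj₂ x∈W)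
    ; (there y∈xs) y∈V → x∈p∪q⁺ (inj₁ (covers y∈xs y∈V)) }

  locally-open⇒open : ∀ V → (∀ {x} → x ∈ V → ∃ λ W → IsOpen τ W × x ∈ W × W ⊆ V) →
    IsOpen τ V
  locally-open⇒open V local with open-cover-of V local (allFin n)
  ... | O , oO , O⊆V , covers = subst (IsOpen τ) (⊆-antisym O⊆V (covers (∈-allFin _))) oO

  upset⇒open : ∀ V → (∀ {x y} → x ≤[ τ ] y → x ∈ V → y ∈ V) → IsOpen τ V
  upset⇒open V upward = locally-open⇒open V λ {x} x∈V →
    let N , oN , x∈N , above = minimal-open-nbhd x
    in N , oN , x∈N , λ y∈N → upward (above y∈N) x∈V

  monotone⇒continuous : ∀ {f} → f Preserves _≤[ τ ]_ ⟶ _≤[ τ ]_ → Continuous τ f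
  monotone⇒continuous {f} mono U oU = upset⇒open (preimage f U) λ x≤y x∈f⁻¹U →
    ∈-preimage⁺ (mono x≤y U oU (∈-preimage⁻ x∈f⁻¹U))

  continuous₂⇔monotone₂ : ∀ {op} →
    Continuous₂ τ op ⇔ op Preserves₂ _≤[ τ ]_ ⟶ _≤[ τ ]_ ⟶ _≤[ τ ]_
  continuous₂⇔monotone₂ {op} = mk⇔ continuous₂⇒monotone₂ monotone₂⇒continuous₂
    where
    continuous₂⇒monotone₂ : Continuous₂ τ op → op Preserves₂ _≤[ τ ]_ ⟶ _≤[ τ ]_ ⟶ _≤[ τ ]_
    continuous₂⇒monotone₂ cont {x} {x′} {y} {y′} x≤x′ y≤y′ U oU xy∈U
      with cont U oU x y xy∈U
    ... | V , W , oV , oW , x∈V , y∈W , V×W⊆U =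
      V×W⊆U x′ y′ (x≤x′ V oV x∈V) (y≤y′ W oW y∈W)

    monotone₂⇒continuous₂ : op Preserves₂ _≤[ τ ]_ ⟶ _≤[ τ ]_ ⟶ _≤[ τ ]_ → Continuous₂ τ op
    monotone₂⇒continuous₂ mono U oU x y xy∈U =
      let V , oV , x∈V , aboveˣ = minimal-open-nbhd x
          W , oW , y∈W , aboveʸ = minimal-open-nbhd y
      in V , W , oV , oW , x∈V , y∈W ,
         λ x′ y′ x′∈V y′∈W → mono (aboveˣ x′∈V) (aboveʸ y′∈W) U oU xy∈U

  involution⇒homeomorphism : ∀ {f} → (∀ x → f (f x) ≡ x) → Continuous τ f → Homeomorphism τ f
  involution⇒homeomorphism {f} involutive cont = f , involutive , involutive , cont , cont

-- OrderIs τ R unfolds to Agrees (_≤[ τ ]_) R.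
Agrees : Rel (Fin n) ℓ → Rel (Fin n) ℓ′ → Set (ℓ ⊔ ℓ′)
Agrees _≤_ R = ∀ x y → (x ≤ y → R x y) × (R x y → x ≤ y)

from-does : ∀ {A : Set ℓ} (a? : Dec A) → T (does a?) → A
from-does (yes a) _ = a

_⇔-dec_ : ∀ {A B : Set ℓ} → Dec A → Dec B → Dec (A ⇔ B)
a? ⇔-dec b? = map′ (uncurry mk⇔) (λ e → Equivalence.to e , Equivalence.from e)
  ((a? →-dec b?) ×-dec (b? →-dec a?))

module _ {_≤_ : Rel (Fin n) ℓ} (_≤?_ : Decidable _≤_) where

  reflexive? : Dec (Reflexive _≤_)
  reflexive? = map′ (λ h {x} → h x) (λ h x → h) (all? λ x → x ≤? x)

  transitive? : Dec (Transitive _≤_)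
  transitive? = map′ (λ h {x} {y} {z} → h x y z) (λ h x y z → h) (all? λ x → all? λ y → all? λ z →
    x ≤? y →-dec y ≤? z →-dec x ≤? z)

  preserves₂? : ∀ op → Dec (op Preserves₂ _≤_ ⟶ _≤_ ⟶ _≤_)
  preserves₂? op = map′ (λ h {x} {x′} {y} {y′} → h x x′ y y′) (λ h x x′ y y′ → h)
    (all? λ x → all? λ x′ → all? λ y → all? λ y′ →
      x ≤? x′ →-dec y ≤? y′ →-dec op x y ≤? op x′ y′)

  agrees? : ∀ {R : Rel (Fin n) ℓ′} → Decidable R → Dec (Agrees _≤_ R)
  agrees? R? = all? λ x → all? λ y → (x ≤? y →-dec R? x y) ×-dec (R? x y →-dec x ≤? y)

allSubset? : ∀ {P : Subset n → Set ℓ} → (∀ U → Dec (P U)) → Dec (∀ U → P U)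
allSubset? P? = map′
  (λ no-counterexample U → decidable-stable (P? U) λ ¬PU → no-counterexample (U , ¬PU))
  (λ all (U , ¬PU) → ¬PU (all U))
  (¬? (anySubset? (¬? ∘ P?)))

relationOf : Subset (n * n) → Fin n → Fin n → Bool
relationOf t x y = lookup t (combine x y)

tableOf : (Fin n → Fin n → Bool) → Subset (n * n)
tableOf {n} r = tabulate (uncurry r ∘ remQuot n)

◁-involutive : ∀ x y → (x ◁ y) ◁ y ≡ x
◁-involutive zero _ = refl
◁-involutive (suc zero) zero = refl
◁-involutive (suc zero) (suc zero) = refl
◁-involutive (suc zero) (suc (suc zero)) = refl
◁-involutive (suc (suc zero)) zero = refl
◁-involutive (suc (suc zero)) (suc zero) = refl
◁-involutive (suc (suc zero)) (suc (suc zero)) = refl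

compatible⇔monotone : ∀ τ → Compatible τ ⇔ _◁_ Preserves₂ _≤[ τ ]_ ⟶ _≤[ τ ]_ ⟶ _≤[ τ ]_
compatible⇔monotone τ = mk⇔
  (Equivalence.to (continuous₂⇔monotone₂ τ) ∘ proj₁)
  λ mono → Equivalence.from (continuous₂⇔monotone₂ τ) mono , λ y →
    involution⇒homeomorphism τ (λ x → ◁-involutive x y)
      (monotone⇒continuous τ λ x≤x′ → mono x≤x′ (≤-refl τ {y}))

InBC? : ∀ x → Dec (InBC x)
InBC? x = x ≟ b ⊎-dec x ≟ c

R₁? : Decidable R₁
R₁? = _≟_

R₂? : Decidable R₂
R₂? _ _ = yes tt

R₃? : Decidable R₃
R₃? x y = x ≟ y ⊎-dec InBC? x ×-dec InBC? y

R₄? : Decidable R₄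
R₄? x y = R₃? x y ⊎-dec x ≟ a

R₅? : Decidable R₅
R₅? x y = R₃? x y ⊎-dec y ≟ a

OneOfFive : Rel X ℓ → Set ℓ
OneOfFive _≤_ = Agrees _≤_ R₁ ⊎ Agrees _≤_ R₂ ⊎ Agrees _≤_ R₃ ⊎ Agrees _≤_ R₄ ⊎ Agrees _≤_ R₅

Classified : Rel X ℓ → Set ℓ
Classified _≤_ = Reflexive _≤_ → Transitive _≤_ →
  (_◁_ Preserves₂ _≤_ ⟶ _≤_ ⟶ _≤_) ⇔ OneOfFive _≤_

classified? : {_≤_ : Rel X ℓ} → Decidable _≤_ → Dec (Classified _≤_)
classified? _≤?_ = reflexive? _≤?_ →-dec transitive? _≤?_ →-dec
  preserves₂? _≤?_ _◁_ ⇔-dec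
  (agrees? _≤?_ R₁? ⊎-dec agrees? _≤?_ R₂? ⊎-dec agrees? _≤?_ R₃? ⊎-dec
   agrees? _≤?_ R₄? ⊎-dec agrees? _≤?_ R₅?)

every-table-classified : ∀ t → T (does (classified? λ x y → T? (relationOf t x y)))
every-table-classified =
  from-does (allSubset? λ t → T? (does (classified? λ x y → T? (relationOf t x y)))) tt

-- The instance below typechecks because does (classified? d) only inspects
-- does (d x y) at closed x and y, where the table returns exactly does (x ≤? y).
classification : {_≤_ : Rel X ℓ} → Decidable _≤_ → Classified _≤_
classification _≤?_ = from-does (classified? _≤?_)
  (every-table-classified (tableOf λ x y → does (x ≤? y)))

mainTheorem5 : (τ : Topology 3) →
    (Compatible τ → OrderIs τ R₁ ⊎ OrderIs τ R₂ ⊎ OrderIs τ R₃ ⊎ OrderIs τ R₄ ⊎ OrderIs τ R₅)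
    × (OrderIs τ R₁ ⊎ OrderIs τ R₂ ⊎ OrderIs τ R₃ ⊎ OrderIs τ R₄ ⊎ OrderIs τ R₅ → Compatible τ)
mainTheorem5 τ = Equivalence.to compatible⇔oneOfFive , Equivalence.from compatible⇔oneOfFive
  where
  compatible⇔oneOfFive : Compatible τ ⇔ OneOfFive (_≤[ τ ]_)
  compatible⇔oneOfFive = ⇔-trans (compatible⇔monotone τ)
    (classification (_≤?_ τ) (≤-refl τ) (≤-trans τ))
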